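{- Let \(\mathcal V\) be a universe. (a) For any \(\delta_{\mathcal V}\)-complete poset \((X,\sqsubseteq)\) and \(x,y:X\), if \(x\) is strictly below \(y\) then \(x\sqsubseteq y\) and \(x\neq y\). (b) If, for all \(x,y:\Omega_{\mathcal V}\) (ordered by implication), \(x\sqsubseteq y\) and \(x\neq y\) together imply that \(x\) is strictly below \(y\), then excluded middle in \(\mathcal V\) holds.
   Context: Setting: intensional Martin-Löf type theory with universes, function extensionality, propositional extensionality, propositional truncation; excluded middle is not assumed. A proposition is a type with at most one element; \(\Omega_{\mathcal V}\) is the type of propositions in \(\mathcal V\), a poset under implication with suprema given by existential quantification. A poset is a type with a proposition-valued reflexive, transitive, antisymmetric relation \(\sqsubseteq\). For \(x\sqsubseteq y\) and a proposition \(P:\mathcal V\), \(\delta_{x,y,P}:\mathbf 1+P\to X\) sends \(\mathrm{inl}(\star)\mapsto x\), \(\mathrm{inr}(p)\mapsto y\); the poset is \(\delta_{\mathcal V}\)-complete if all such families have suprema \(\bigvee\delta_{x,y,P}\). In a \(\delta_{\mathcal V}\)-complete poset, \(x\) is strictly below \(y\) if \(x\sqsubseteq y\) and for every \(z\) with \(y\sqsubseteq z\) and every proposition \(P:\mathcal V\), \(z=\bigvee\delta_{x,z,P}\) implies \(P\). Excluded middle in \(\mathcal V\): \(P\) or \(\neg P\) for every proposition \(P:\mathcal V\). -}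

module Defs where

open import Level using (Level; _⊔_; suc; Setω)
open import Data.Product using (Σ; _×_; _,_; proj₁; proj₂)
open import Data.Sum using (_⊎_; inj₁; inj₂)
open import Data.Unit.Polymorphic using (⊤; tt)
open import Relation.Binary.PropositionalEquality using (_≡_; _≢_)
open import Relation.Nullary using (¬_)

is-prop : ∀ {a} → Set a → Set a
is-prop A = (x y : A) → x ≡ y

Funext : Setω
Funext = ∀ {a b} {A : Set a} {B : A → Set b} {f g : (x : A) → B x}
       → ((x : A) → f x ≡ g x) → f ≡ g

Propext : (v : Level) → Set (suc v)
Propext v = {P Q : Set v} → is-prop P → is-prop Q → (P → Q) → (Q → P) → P ≡ Q

record PropTrunc : Setω where
  field
    ∥_∥      : ∀ {a} → Set a → Set a
    ∥∥-is-prop : ∀ {a} {A : Set a} → is-prop ∥ A ∥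
    ∣_∣      : ∀ {a} {A : Set a} → A → ∥ A ∥
    ∥∥-rec   : ∀ {a b} {A : Set a} {B : Set b} → is-prop B → (A → B) → ∥ A ∥ → B

EM : (v : Level) → Set (suc v)
EM v = (P : Set v) → is-prop P → P ⊎ ¬ P

record Poset (u t : Level) : Set (suc (u ⊔ t)) where
  field
    Carrier   : Set u
    _⊑_       : Carrier → Carrier → Set t
    ⊑-prop    : ∀ x y → is-prop (x ⊑ y)
    ⊑-refl    : ∀ x → x ⊑ x
    ⊑-trans   : ∀ x y z → x ⊑ y → y ⊑ z → x ⊑ z
    ⊑-antisym : ∀ x y → x ⊑ y → y ⊑ x → x ≡ y

module _ {u t : Level} (X : Poset u t) where
  open Poset X

  is-sup : ∀ {i} {I : Set i} → Carrier → (I → Carrier) → Set (u ⊔ t ⊔ i)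
  is-sup {I = I} s α = ((k : I) → α k ⊑ s) × ((w : Carrier) → ((k : I) → α k ⊑ w) → s ⊑ w)

  δ : ∀ {v} (x y : Carrier) → x ⊑ y → (P : Set v) → is-prop P → ⊤ {v} ⊎ P → Carrier
  δ x y _ P _ (inj₁ _) = x
  δ x y _ P _ (inj₂ _) = y

record δ-complete (v : Level) {u t : Level} (X : Poset u t) : Set (suc v ⊔ u ⊔ t) where
  open Poset X
  field
    ⋁δ        : (x y : Carrier) → x ⊑ y → (P : Set v) → is-prop P → Carrier
    ⋁δ-is-sup : (x y : Carrier) (l : x ⊑ y) (P : Set v) (i : is-prop P)
              → is-sup X (⋁δ x y l P i) (δ X x y l P i)

strictly-below : ∀ {v u t} {X : Poset u t} → δ-complete v X
               → Poset.Carrier X → Poset.Carrier X → Set (suc v ⊔ u ⊔ t)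
strictly-below {v} {X = X} D x y =
  Σ (x ⊑ y) λ l →
    (z : Carrier) (m : y ⊑ z) (P : Set v) (i : is-prop P)
    → z ≡ ⋁δ x z (⊑-trans x y z l m) P i → P
  where
  open Poset X
  open δ-complete D

Ω : (v : Level) → Set (suc v)
Ω v = Σ (Set v) is-prop

Ω-poset : Funext → ∀ {v} → Propext v → Poset (suc v) v
Ω-poset fe {v} pe = record
  { Carrier   = Ω v
  ; _⊑_       = λ p q → proj₁ p → proj₁ q
  ; ⊑-prop    = λ p q f g → fe λ a → proj₂ q (f a) (g a)
  ; ⊑-refl    = λ _ a → a
  ; ⊑-trans   = λ _ _ _ f g a → g (f a)
  ; ⊑-antisym = antisym
  }
  where
  is-prop-is-prop : ∀ {A : Set v} → is-prop (is-prop A)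
  is-prop-is-prop {A} h k = fe λ a → fe λ b → set (h a b) (k a b)
    where
    open import Relation.Binary.PropositionalEquality using (refl; trans; sym; cong)
    -- propositions are sets (Hedberg-style argument)
    hc : (a b : A) → a ≡ b → a ≡ b
    hc a b _ = h a b
    lemma : {a b : A} (q : a ≡ b) → trans (sym (h a a)) (h a b) ≡ q
    lemma {a} refl = left-inv (h a a)
      where
      left-inv : ∀ {x y : A} (r : x ≡ y) → trans (sym r) r ≡ refl
      left-inv refl = refl
    set : {a b : A} (q r : a ≡ b) → q ≡ r
    set q r = trans (sym (lemma q)) (lemma r)
  antisym : (p q : Ω v) → (proj₁ p → proj₁ q) → (proj₁ q → proj₁ p) → p ≡ q
  antisym (P , i) (Q , j) f g with pe i j f g
  ... | Relation.Binary.PropositionalEquality.refl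
      with is-prop-is-prop i j
  ...   | Relation.Binary.PropositionalEquality.refl = Relation.Binary.PropositionalEquality.refl

Ω-δ-complete : (fe : Funext) → PropTrunc → ∀ {v} (pe : Propext v)
             → δ-complete v (Ω-poset fe pe)
Ω-δ-complete fe pt {v} pe = record
  { ⋁δ        = λ x y l P i → sup (δ (Ω-poset fe pe) x y l P i)
  ; ⋁δ-is-sup = λ x y l P i →
      (λ k a → ∣ k , a ∣) ,
      (λ w ub → ∥∥-rec (proj₂ w) λ { (k , a) → ub k a })
  }
  where
  open PropTrunc pt
  sup : {I : Set v} → (I → Ω v) → Ω v
  sup {I} α = ∥ Σ I (λ k → proj₁ (α k)) ∥ , ∥∥-is-prop

record _×ω_ (A B : Setω) : Setω where
  constructor _,ω_
  field
    part-a : A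
    part-b : B

-- (a) If x = y, then the supremum of δ_{x,x,𝟘} is x itself, so strict
-- inequality of x below x would yield an element of 𝟘.
-- (b) In Ω, the supremum of δ_{𝟘,P,P} is P. So if ⊥ is strictly below every
-- proposition P different from ⊥, that is, every P with ¬¬P, then ¬¬P → P;
-- double-negation elimination applied to the proposition P + ¬P gives excluded middle.
{-# OPTIONS --safe #-}
module Submission where

open import Defs
open import Level using (Level)
open import Data.Product using (_×_; _,_; proj₁; proj₂)
open import Data.Sum using (_⊎_; inj₁; inj₂)
open import Data.Empty using (⊥-elim)
import Data.Empty.Polymorphic as Poly
open import Data.Unit.Polymorphic using (tt)
open import Function using (id; _∘_)
open import Relation.Nullary using (¬_)
open import Relation.Binary.PropositionalEquality using (_≡_; _≢_; refl; sym; cong; subst)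

module _ {v u t : Level} {X : Poset u t} (D : δ-complete v X) where
  open Poset X
  open δ-complete D

  ⋁δ-refuted : ∀ x y (l : x ⊑ y) (P : Set v) (i : is-prop P) → ¬ P → ⋁δ x y l P i ≡ x
  ⋁δ-refuted x y l P i ¬p =
    ⊑-antisym _ x (proj₂ (⋁δ-is-sup x y l P i) x below-x) (proj₁ (⋁δ-is-sup x y l P i) (inj₁ tt))
    where
    below-x : ∀ k → δ X x y l P i k ⊑ x
    below-x (inj₁ _) = ⊑-refl x
    below-x (inj₂ p) = ⊥-elim (¬p p)

  strictly-below-irrefl : ∀ x → ¬ strictly-below D x x
  strictly-below-irrefl x (l , strict) =
    Poly.⊥-elim (strict x l Poly.⊥ (λ ()) (sym (⋁δ-refuted x x _ Poly.⊥ (λ ()) λ ())))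

  strictly-below⇒⊑×≢ : ∀ x y → strictly-below D x y → x ⊑ y × x ≢ y
  strictly-below⇒⊑×≢ x y x≺y = proj₁ x≺y , λ { refl → strictly-below-irrefl x x≺y }

DNE : (v : Level) → Set (Level.suc v)
DNE v = (P : Set v) → is-prop P → ¬ ¬ P → P

⊎¬-is-prop : Funext → ∀ {v} {P : Set v} → is-prop P → is-prop (P ⊎ ¬ P)
⊎¬-is-prop fe i (inj₁ p) (inj₁ q)  = cong inj₁ (i p q)
⊎¬-is-prop fe i (inj₁ p) (inj₂ ¬q) = ⊥-elim (¬q p)
⊎¬-is-prop fe i (inj₂ ¬p) (inj₁ q) = ⊥-elim (¬p q)
⊎¬-is-prop fe i (inj₂ ¬p) (inj₂ ¬q) = cong inj₂ (fe λ p → ⊥-elim (¬p p))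

DNE⇒EM : Funext → ∀ {v} → DNE v → EM v
DNE⇒EM fe dne P i = dne (P ⊎ ¬ P) (⊎¬-is-prop fe i) λ k → k (inj₂ (k ∘ inj₁))

module _ (fe : Funext) (pt : PropTrunc) {v : Level} (pe : Propext v) where
  open Poset (Ω-poset fe pe)
  open δ-complete (Ω-δ-complete fe pt pe)

  ⊥Ω : Ω v
  ⊥Ω = Poly.⊥ , λ ()

  ¬¬⇒≢⊥Ω : ∀ {P : Set v} (i : is-prop P) → ¬ ¬ P → ⊥Ω ≢ (P , i)
  ¬¬⇒≢⊥Ω i ¬¬p ⊥≡P = ¬¬p λ p → Poly.⊥-elim (subst id (cong proj₁ (sym ⊥≡P)) p)

  Ω-⋁δ-self : ∀ x (P : Set v) (i : is-prop P) (l : x ⊑ (P , i)) → (P , i) ≡ ⋁δ x (P , i) l P i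
  Ω-⋁δ-self x P i l = ⊑-antisym _ _ (λ p → proj₁ sup (inj₂ p) p) (proj₂ sup (P , i) below-P)
    where
    sup = ⋁δ-is-sup x (P , i) l P i
    below-P : ∀ k → δ (Ω-poset fe pe) x (P , i) l P i k ⊑ (P , i)
    below-P (inj₁ _) = l
    below-P (inj₂ _) = id

  strictly-above-⊥Ω-holds : ∀ (P : Set v) (i : is-prop P)
                          → strictly-below (Ω-δ-complete fe pt pe) ⊥Ω (P , i) → P
  strictly-above-⊥Ω-holds P i (l , strict) = strict (P , i) id P i (Ω-⋁δ-self ⊥Ω P i (⊑-trans ⊥Ω (P , i) (P , i) l id))

  ≢⇒strictly-below⇒DNE : ((x y : Ω v) → x ⊑ y → x ≢ y → strictly-below (Ω-δ-complete fe pt pe) x y)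
                        → DNE v
  ≢⇒strictly-below⇒DNE H P i ¬¬p =
    strictly-above-⊥Ω-holds P i (H ⊥Ω (P , i) (λ ()) (¬¬⇒≢⊥Ω i ¬¬p))

proposition3p10 :
    (∀ {v u t : Level} (X : Poset u t) (D : δ-complete v X) (x y : Poset.Carrier X)
       → strictly-below D x y → Poset._⊑_ X x y × x ≢ y)
    ×ω
    ((fe : Funext) (pt : PropTrunc) {v : Level} (pe : Propext v)
       → ((x y : Ω v) → Poset._⊑_ (Ω-poset fe pe) x y → x ≢ y
            → strictly-below (Ω-δ-complete fe pt pe) x y)
       → EM v)
proposition3p10 =
  (λ X D → strictly-below⇒⊑×≢ D)
  ,ω
  (λ fe pt pe H → DNE⇒EM fe (≢⇒strictly-below⇒DNE fe pt pe H))
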